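{- Let $n$ and $r$ be positive integers. Let $Q(n,r)$ denote the number of lattice paths in the plane using unit steps $(1,0)$ and $(0,1)$ from $(0,0)$ to $(n+r,\,n+r-1)$ that never touch any point of the set $\{(x,x)\in\mathbb{Z}^2 : 1\le x\le r\}$. Then \[ Q(n,r)=\sum_{k=1}^{n} C_{r+k-1}\binom{2(n-k)}{n-k}, \] where $C_m=\frac{1}{m+1}\binom{2m}{m}$ is the $m$th Catalan number.
   Context: $C_m=\frac{1}{m+1}\binom{2m}{m}$ denotes the $m$th Catalan number. -}

module Defs where

open import Data.Nat using (ℕ; zero; suc; _+_; _*_; _∸_; _≡ᵇ_; _/_)
open import Data.Nat.Combinatorics using (_C_)
open import Data.Bool using (Bool; true; false; _∧_; _∨_; not)
open import Data.List using (List; []; _∷_; map; _++_; length; filter; foldr)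
open import Data.Product using (_×_; _,_)
open import Relation.Nullary.Decidable using (Dec)
open import Relation.Binary.PropositionalEquality using (_≡_)
open import Data.Bool.Properties using (T?)
open import Data.Bool using (T)

data Step : Set where
  E N : Step

allWords : ℕ → List (List Step)
allWords zero = [] ∷ []
allWords (suc ℓ) = map (E ∷_) (allWords ℓ) ++ map (N ∷_) (allWords ℓ)

Point : Set
Point = ℕ × ℕ

move : Point → Step → Point
move (x , y) E = (suc x , y)
move (x , y) N = (x , suc y)

visits : Point → List Step → List Point
visits p [] = p ∷ []
visits p (s ∷ w) = p ∷ visits (move p s) w

endpoint : Point → List Step → Point
endpoint p [] = p
endpoint p (s ∷ w) = endpoint (move p s) w

_≤ᵇ'_ : ℕ → ℕ → Bool
zero ≤ᵇ' _ = true
suc m ≤ᵇ' zero = false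
suc m ≤ᵇ' suc n = m ≤ᵇ' n

forbidden : ℕ → Point → Bool
forbidden r (x , y) = (x ≡ᵇ y) ∧ (1 ≤ᵇ' x) ∧ (x ≤ᵇ' r)

anyB : {A : Set} → (A → Bool) → List A → Bool
anyB f = foldr (λ a b → f a ∨ b) false

validQ : ℕ → ℕ → List Step → Bool
validQ n r w =
  let (ex , ey) = endpoint (0 , 0) w in
  (ex ≡ᵇ (n + r)) ∧ (ey ≡ᵇ (n + r ∸ 1)) ∧ not (anyB (forbidden r) (visits (0 , 0) w))

-- Every monotone path from (0,0) to (a,b) has exactly a+b steps, so
-- enumerating all words of length 2(n+r)-1 covers all such paths.
Q : ℕ → ℕ → ℕ
Q n r = length (filter (λ w → T? (validQ n r w)) (allWords ((n + r) + (n + r ∸ 1))))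

catalan : ℕ → ℕ
catalan m = ((2 * m) C m) / suc m

sum1to : ℕ → (ℕ → ℕ) → ℕ
sum1to zero f = 0
sum1to (suc n) f = sum1to n f + f (suc n)

-- Enlarging the forbidden set for r to the one for r + 1 adds the single point M = (r+1, r+1),
-- so Q(n+1, r) − Q(n, r+1) counts the paths through M, i.e. (paths to M) · (paths from M).
-- The last step into M comes from (r+1, r) or (r, r+1), and each of these is reached in
-- C(2r, r) − C(2r, r+1) = C_r ways by André's reflection principle; beyond M every point has
-- x > r, so all C(2n−1, n) continuations are allowed, and 2 C(2n−1, n) = C(2n, n).
-- Hence Q(n+1, r) = Q(n, r+1) + C_r C(2n, n), with Q(1, r) = C_r the ballot number,
-- and the sum formula follows by induction on n.
module Submission where

open import Data.Bool using (Bool; true; false; _∧_; not; if_then_else_; T)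
open import Data.Bool.Properties using (T?; ∧-comm; ∧-zeroʳ)
open import Data.Empty using (⊥-elim)
open import Data.List using (List; []; _∷_; map; _++_; length; filter)
open import Data.Nat
open import Data.Nat.Properties
open import Data.Nat.Combinatorics
open import Data.Nat.DivMod using (m*n/n≡m; m/n*n≡m)
open import Data.Nat.Tactic.RingSolver using (solve-∀)
open import Data.Product using (_×_; _,_; proj₁; proj₂; swap)
open import Data.Product.Properties using (≡-dec)
open import Data.Sum using (inj₁; inj₂)
open import Data.Unit using (tt)
open import Function using (_∘_)
open import Relation.Binary.Definitions using (DecidableEquality; tri<; tri≈; tri>)
open import Relation.Binary.PropositionalEquality
open import Relation.Nullary using (¬_; yes; no)
open import Defs

open import Algebra.Properties.CommutativeSemigroup +-commutativeSemigroup using () renaming (interchange to +-interchange)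

isPath : (Point → Bool) → Point → Point → List Step → Bool
isPath bad p t w =
  (proj₁ (endpoint p w) ≡ᵇ proj₁ t) ∧ (proj₂ (endpoint p w) ≡ᵇ proj₂ t) ∧ not (anyB bad (visits p w))

#paths : (Point → Bool) → ℕ → Point → Point → ℕ
#paths bad zero    p t = if bad p then 0 else (if (proj₁ p ≡ᵇ proj₁ t) ∧ (proj₂ p ≡ᵇ proj₂ t) then 1 else 0)
#paths bad (suc ℓ) p t = if bad p then 0 else #paths bad ℓ (move p E) t + #paths bad ℓ (move p N) t

count : {A : Set} → (A → Bool) → List A → ℕ
count f []       = 0
count f (a ∷ as) = if f a then suc (count f as) else count f as

length-filter≡count : ∀ {A : Set} (f : A → Bool) xs → length (filter (λ a → T? (f a)) xs) ≡ count f xs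
length-filter≡count f []       = refl
length-filter≡count f (a ∷ as) with f a
... | true  = cong suc (length-filter≡count f as)
... | false = length-filter≡count f as

count-++ : ∀ {A : Set} (f : A → Bool) xs ys → count f (xs ++ ys) ≡ count f xs + count f ys
count-++ f []       ys = refl
count-++ f (a ∷ as) ys with f a
... | true  = cong suc (count-++ f as ys)
... | false = count-++ f as ys

count-map : ∀ {A B : Set} (f : B → Bool) (g : A → Bool) (h : A → B) →
            (∀ a → f (h a) ≡ g a) → ∀ xs → count f (map h xs) ≡ count g xs
count-map f g h f∘h≗g []       = refl
count-map f g h f∘h≗g (a ∷ as) rewrite f∘h≗g a with g a
... | true  = cong suc (count-map f g h f∘h≗g as)
... | false = count-map f g h f∘h≗g as

count-false : ∀ {A : Set} (xs : List A) → count (λ _ → false) xs ≡ 0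
count-false []       = refl
count-false (_ ∷ xs) = count-false xs

module _ (bad : Point → Bool) (p t : Point) (s : Step) (w : List Step) where

  isPath-∷ : bad p ≡ false → isPath bad p t (s ∷ w) ≡ isPath bad (move p s) t w
  isPath-∷ p-ok rewrite p-ok = refl

  isPath-∷-bad : bad p ≡ true → isPath bad p t (s ∷ w) ≡ false
  isPath-∷-bad p-bad rewrite p-bad = trans (cong (reaches₁ ∧_) (∧-zeroʳ reaches₂)) (∧-zeroʳ reaches₁)
    where
    reaches₁ = proj₁ (endpoint (move p s) w) ≡ᵇ proj₁ t
    reaches₂ = proj₂ (endpoint (move p s) w) ≡ᵇ proj₂ t

count-isPath : ∀ bad ℓ p t → count (isPath bad p t) (allWords ℓ) ≡ #paths bad ℓ p t
count-isPath bad zero p t with bad p | proj₁ p ≡ᵇ proj₁ t | proj₂ p ≡ᵇ proj₂ t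
... | true  | true  | true  = refl
... | true  | true  | false = refl
... | true  | false | _     = refl
... | false | true  | true  = refl
... | false | true  | false = refl
... | false | false | _     = refl
count-isPath bad (suc ℓ) p t with bad p in p-bad?
... | true  = trans (count-++ _ (map (E ∷_) W) _) (cong₂ _+_ (dead E) (dead N))
  where
  W = allWords ℓ
  dead : ∀ s → count (isPath bad p t) (map (s ∷_) W) ≡ 0
  dead s = trans (count-map _ _ (s ∷_) (λ w → isPath-∷-bad bad p t s w p-bad?) W) (count-false W)
... | false = trans (count-++ _ (map (E ∷_) W) _) (cong₂ _+_ (live E) (live N))
  where
  W = allWords ℓ
  live : ∀ s → count (isPath bad p t) (map (s ∷_) W) ≡ #paths bad ℓ (move p s) t
  live s = trans (count-map _ _ (s ∷_) (λ w → isPath-∷ bad p t s w p-bad?) W) (count-isPath bad ℓ (move p s) t)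

Q≡#paths : ∀ n r {K} → n + r ≡ K → Q n r ≡ #paths (forbidden r) (K + (K ∸ 1)) (0 , 0) (K , K ∸ 1)
Q≡#paths n r refl = trans (length-filter≡count (validQ n r) (allWords ℓ)) (count-isPath (forbidden r) ℓ (0 , 0) (n + r , n + r ∸ 1))
  where ℓ = (n + r) + (n + r ∸ 1)

level : Point → ℕ
level (x , y) = x + y

_≤ₚ_ : Point → Point → Set
(x , y) ≤ₚ (x′ , y′) = x ≤ x′ × y ≤ y′

_≟ₚ_ : DecidableEquality Point
_≟ₚ_ = ≡-dec _≟_ _≟_

≤ₚ-refl : ∀ {p} → p ≤ₚ p
≤ₚ-refl = ≤-refl , ≤-refl

≤ₚ-move : ∀ {p q} s → move p s ≤ₚ q → p ≤ₚ q
≤ₚ-move E (x<x′ , y≤y′) = <⇒≤ x<x′ , y≤y′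
≤ₚ-move N (x≤x′ , y<y′) = x≤x′ , <⇒≤ y<y′

≤ₚ-antisym-level : ∀ {p q} → p ≤ₚ q → level p ≡ level q → p ≡ q
≤ₚ-antisym-level {x , y} {x′ , y′} (x≤x′ , y≤y′) eq with m≤n⇒m<n∨m≡n x≤x′
... | inj₁ x<x′ = ⊥-elim (<-irrefl eq (+-mono-<-≤ x<x′ y≤y′))
... | inj₂ refl = cong (x ,_) (+-cancelˡ-≡ x y y′ eq)

level-move : ∀ p s → level (move p s) ≡ suc (level p)
level-move (x , y) E = refl
level-move (x , y) N = +-suc x y

move-injective : ∀ {p q} s → move p s ≡ move q s → p ≡ q
move-injective E refl = refl
move-injective N refl = refl

≡ᵇ-refl : ∀ x → (x ≡ᵇ x) ≡ true
≡ᵇ-refl zero    = refl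
≡ᵇ-refl (suc x) = ≡ᵇ-refl x

≡ᵇ⇒≡′ : ∀ {x y} → (x ≡ᵇ y) ≡ true → x ≡ y
≡ᵇ⇒≡′ {x} {y} eq = ≡ᵇ⇒≡ x y (subst T (sym eq) tt)

module _ (bad : Point → Bool) where

  #paths-from-bad : ∀ ℓ {p t} → bad p ≡ true → #paths bad ℓ p t ≡ 0
  #paths-from-bad zero    p-bad rewrite p-bad = refl
  #paths-from-bad (suc ℓ) p-bad rewrite p-bad = refl

  #paths-step : ∀ ℓ {p t} → bad p ≡ false →
                #paths bad (suc ℓ) p t ≡ #paths bad ℓ (move p E) t + #paths bad ℓ (move p N) t
  #paths-step ℓ p-ok rewrite p-ok = refl

  #paths-stay : ∀ {t} → bad t ≡ false → #paths bad 0 t t ≡ 1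
  #paths-stay {x , y} t-ok rewrite t-ok | ≡ᵇ-refl x | ≡ᵇ-refl y = refl

  #paths-miss : ∀ {p t} → p ≢ t → #paths bad 0 p t ≡ 0
  #paths-miss {x , y} {X , Y} p≢t with bad (x , y) | x ≡ᵇ X in x≟X | y ≡ᵇ Y in y≟Y
  ... | true  | _     | _     = refl
  ... | false | false | _     = refl
  ... | false | true  | false = refl
  ... | false | true  | true  = ⊥-elim (p≢t (cong₂ _,_ (≡ᵇ⇒≡′ x≟X) (≡ᵇ⇒≡′ y≟Y)))

  #paths-level : ∀ ℓ p t → level p + ℓ ≢ level t → #paths bad ℓ p t ≡ 0
  #paths-level zero    p t ≢level = #paths-miss (λ p≡t → ≢level (trans (+-identityʳ _) (cong level p≡t)))
  #paths-level (suc ℓ) p t ≢level with bad p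
  ... | true  = refl
  ... | false = cong₂ _+_ (after E) (after N)
    where
    after : ∀ s → #paths bad ℓ (move p s) t ≡ 0
    after s = #paths-level ℓ (move p s) t
      (λ eq → ≢level (trans (+-suc (level p) ℓ) (trans (cong (_+ ℓ) (sym (level-move p s))) eq)))

  #paths-unreachable : ∀ ℓ {p t} → ¬ p ≤ₚ t → #paths bad ℓ p t ≡ 0
  #paths-unreachable zero    p≰t = #paths-miss (λ { refl → p≰t ≤ₚ-refl })
  #paths-unreachable (suc ℓ) {p} p≰t with bad p
  ... | true  = refl
  ... | false = cong₂ _+_ (#paths-unreachable ℓ (p≰t ∘ ≤ₚ-move E)) (#paths-unreachable ℓ (p≰t ∘ ≤ₚ-move N))

  #paths-cong : ∀ bad′ ℓ {p t} → (∀ q → p ≤ₚ q → bad q ≡ bad′ q) → #paths bad ℓ p t ≡ #paths bad′ ℓ p t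
  #paths-cong bad′ zero    {p} agree rewrite agree p ≤ₚ-refl = refl
  #paths-cong bad′ (suc ℓ) {p} agree rewrite agree p ≤ₚ-refl with bad′ p
  ... | true  = refl
  ... | false = cong₂ _+_ (#paths-cong bad′ ℓ (λ q → agree q ∘ ≤ₚ-move E)) (#paths-cong bad′ ℓ (λ q → agree q ∘ ≤ₚ-move N))

  #paths-swap : (∀ q → bad (swap q) ≡ bad q) → ∀ ℓ p t → #paths bad ℓ p t ≡ #paths bad ℓ (swap p) (swap t)
  #paths-swap bad-sym zero    (x , y) (X , Y) rewrite bad-sym (x , y) = cong (λ b → if bad (x , y) then 0 else (if b then 1 else 0)) (∧-comm (x ≡ᵇ X) (y ≡ᵇ Y))
  #paths-swap bad-sym (suc ℓ) (x , y) t rewrite bad-sym (x , y) with bad (x , y)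
  ... | true  = refl
  ... | false = trans (cong₂ _+_ (#paths-swap bad-sym ℓ (suc x , y) t) (#paths-swap bad-sym ℓ (x , suc y) t))
                      (+-comm (#paths bad ℓ (y , suc x) (swap t)) _)

  #paths-0-move : ∀ {p q} s → bad p ≡ false → bad (move q s) ≡ false → #paths bad 0 (move p s) (move q s) ≡ #paths bad 0 p q
  #paths-0-move {p} {q} s p-ok q′-ok with p ≟ₚ q
  ... | yes refl = trans (#paths-stay q′-ok) (sym (#paths-stay p-ok))
  ... | no  p≢q  = trans (#paths-miss (p≢q ∘ move-injective s)) (sym (#paths-miss p≢q))

  #paths-last : ∀ {X Y} → bad (suc X , suc Y) ≡ false → ∀ ℓ p →
                #paths bad (suc ℓ) p (suc X , suc Y) ≡ #paths bad ℓ p (X , suc Y) + #paths bad ℓ p (suc X , Y)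
  #paths-last t-ok ℓ p with bad p in p-ok
  ... | true = sym (cong₂ _+_ (#paths-from-bad ℓ p-ok) (#paths-from-bad ℓ p-ok))
  #paths-last t-ok zero    p | false = cong₂ _+_ (#paths-0-move E p-ok t-ok) (#paths-0-move N p-ok t-ok)
  #paths-last {X} {Y} t-ok (suc ℓ) p | false = begin
    #paths bad (suc ℓ) pᴱ (suc X , suc Y) + #paths bad (suc ℓ) pᴺ (suc X , suc Y)
      ≡⟨ cong₂ _+_ (#paths-last t-ok ℓ pᴱ) (#paths-last t-ok ℓ pᴺ) ⟩
    (#paths bad ℓ pᴱ (X , suc Y) + #paths bad ℓ pᴱ (suc X , Y)) + (#paths bad ℓ pᴺ (X , suc Y) + #paths bad ℓ pᴺ (suc X , Y))
      ≡⟨ +-interchange (#paths bad ℓ pᴱ (X , suc Y)) _ _ _ ⟩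
    (#paths bad ℓ pᴱ (X , suc Y) + #paths bad ℓ pᴺ (X , suc Y)) + (#paths bad ℓ pᴱ (suc X , Y) + #paths bad ℓ pᴺ (suc X , Y))
      ≡⟨ cong₂ _+_ (#paths-step ℓ p-ok) (#paths-step ℓ p-ok) ⟨
    #paths bad (suc ℓ) p (X , suc Y) + #paths bad (suc ℓ) p (suc X , Y) ∎
    where
    open ≡-Reasoning
    pᴱ = move p E
    pᴺ = move p N

free : Point → Bool
free _ = false

#free-paths : ∀ ℓ a b x y → a + b ≡ ℓ → #paths free ℓ (x , y) (x + a , y + b) ≡ ℓ C a
#free-paths zero zero zero x y refl rewrite +-identityʳ x | +-identityʳ y = #paths-stay free {x , y} refl
#free-paths (suc ℓ) zero (suc b) x y eq rewrite +-suc y b =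
  cong₂ _+_ (#paths-unreachable free ℓ (λ (x<x , _) → <-irrefl (sym (+-identityʳ x)) x<x))
            (#free-paths ℓ 0 b x (suc y) (suc-injective eq))
#free-paths (suc ℓ) (suc a) zero x y eq rewrite +-suc x a = begin
  #paths free ℓ (suc x , y) (suc x + a , y + 0) + #paths free ℓ (x , suc y) (suc x + a , y + 0)
    ≡⟨ cong₂ _+_ (#free-paths ℓ a 0 (suc x) y (suc-injective eq))
                 (#paths-unreachable free ℓ (λ (_ , y<y) → <-irrefl (sym (+-identityʳ y)) y<y)) ⟩
  ℓ C a + 0
    ≡⟨ cong (ℓ C a +_) (k>n⇒nCk≡0 (s≤s (≤-reflexive (trans (sym (suc-injective eq)) (+-identityʳ a))))) ⟨
  ℓ C a + ℓ C suc a
    ≡⟨ nCk+nC[k+1]≡[n+1]C[k+1] ℓ a ⟩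
  suc ℓ C suc a ∎
  where open ≡-Reasoning
#free-paths (suc ℓ) (suc a) (suc b) x y eq =
  trans (cong₂ _+_ viaE viaN) (nCk+nC[k+1]≡[n+1]C[k+1] ℓ a)
  where
  viaE : #paths free ℓ (suc x , y) (x + suc a , y + suc b) ≡ ℓ C a
  viaE = subst (λ X → #paths free ℓ (suc x , y) (X , y + suc b) ≡ ℓ C a) (sym (+-suc x a))
               (#free-paths ℓ a (suc b) (suc x) y (suc-injective eq))
  viaN : #paths free ℓ (x , suc y) (x + suc a , y + suc b) ≡ ℓ C suc a
  viaN = subst (λ Y → #paths free ℓ (x , suc y) (x + suc a , Y) ≡ ℓ C suc a) (sym (+-suc y b))
               (#free-paths ℓ (suc a) b x (suc y) (trans (sym (+-suc a b)) (suc-injective eq)))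

module _ (bad bad′ : Point → Bool) (m : Point) (m-ok : bad m ≡ false) (m-bad : bad′ m ≡ true)
         (agree : ∀ q → q ≢ m → bad′ q ≡ bad q) where

  -- From p ≠ m on m's level the upper cone of p misses m; from any other level no path reaches t in ℓ′ steps.
  #paths-off-m : ∀ ℓ′ {p t} → p ≢ m → level m + ℓ′ ≡ level t → #paths bad ℓ′ p t ≡ #paths bad′ ℓ′ p t
  #paths-off-m ℓ′ {p} {t} p≢m m↝t with level p ≟ level m
  ... | yes same-level = #paths-cong bad bad′ ℓ′ λ q p≤q →
          sym (agree q λ { refl → p≢m (≤ₚ-antisym-level p≤q same-level) })
  ... | no  other-level = trans (#paths-level bad ℓ′ p t misses) (sym (#paths-level bad′ ℓ′ p t misses))
    where
    misses : level p + ℓ′ ≢ level t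
    misses p↝t = other-level (+-cancelʳ-≡ ℓ′ (level p) (level m) (trans p↝t (sym m↝t)))

  #paths-through : ∀ ℓ ℓ′ p t → level m + ℓ′ ≡ level t →
                   #paths bad (ℓ + ℓ′) p t ≡ #paths bad′ (ℓ + ℓ′) p t + #paths bad ℓ p m * #paths bad ℓ′ m t
  #paths-through zero ℓ′ p t m↝t with p ≟ₚ m
  ... | yes refl = sym (trans (cong₂ (λ u v → u + v * #paths bad ℓ′ m t) (#paths-from-bad bad′ ℓ′ m-bad) (#paths-stay bad m-ok))
                              (+-identityʳ _))
  ... | no  p≢m  = trans (#paths-off-m ℓ′ p≢m m↝t)
                         (sym (trans (cong (λ v → #paths bad′ ℓ′ p t + v * #paths bad ℓ′ m t) (#paths-miss bad p≢m))
                                     (+-identityʳ _)))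
  #paths-through (suc k) ℓ′ p t m↝t with p ≟ₚ m
  ... | yes refl = trans (#paths-level bad (suc k + ℓ′) m t too-long)
                         (sym (cong₂ (λ u v → u + v * #paths bad ℓ′ m t)
                                     (#paths-level bad′ (suc k + ℓ′) m t too-long)
                                     (#paths-level bad (suc k) m m (λ eq → m+1+n≢m (level m) eq))))
    where
    too-long : level m + (suc k + ℓ′) ≢ level t
    too-long eq = m≢1+n+m ℓ′ (sym (+-cancelˡ-≡ (level m) (suc k + ℓ′) ℓ′ (trans eq (sym m↝t))))
  ... | no p≢m rewrite agree p p≢m with bad p
  ...   | true  = refl
  ...   | false = begin
    #paths bad (k + ℓ′) pᴱ t + #paths bad (k + ℓ′) pᴺ t
      ≡⟨ cong₂ _+_ (#paths-through k ℓ′ pᴱ t m↝t) (#paths-through k ℓ′ pᴺ t m↝t) ⟩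
    (#paths bad′ (k + ℓ′) pᴱ t + #paths bad k pᴱ m * c) + (#paths bad′ (k + ℓ′) pᴺ t + #paths bad k pᴺ m * c)
      ≡⟨ collect (#paths bad′ (k + ℓ′) pᴱ t) (#paths bad k pᴱ m) (#paths bad′ (k + ℓ′) pᴺ t) (#paths bad k pᴺ m) c ⟩
    (#paths bad′ (k + ℓ′) pᴱ t + #paths bad′ (k + ℓ′) pᴺ t) + (#paths bad k pᴱ m + #paths bad k pᴺ m) * c ∎
    where
    open ≡-Reasoning
    pᴱ = move p E
    pᴺ = move p N
    c = #paths bad ℓ′ m t
    collect : ∀ a A b B c → (a + A * c) + (b + B * c) ≡ (a + b) + (A + B) * c
    collect = solve-∀

≡ᵇ-false : ∀ {x y} → x ≢ y → (x ≡ᵇ y) ≡ false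
≡ᵇ-false {x} {y} x≢y with x ≡ᵇ y in x≟y
... | true  = ⊥-elim (x≢y (≡ᵇ⇒≡′ x≟y))
... | false = refl

≤ᵇ′-true : ∀ {m n} → m ≤ n → (m ≤ᵇ' n) ≡ true
≤ᵇ′-true {zero}          _         = refl
≤ᵇ′-true {suc m} {suc n} (s≤s m≤n) = ≤ᵇ′-true m≤n

≤ᵇ′-false : ∀ {m n} → n < m → (m ≤ᵇ' n) ≡ false
≤ᵇ′-false {suc m} {zero}  _         = refl
≤ᵇ′-false {suc m} {suc n} (s≤s n<m) = ≤ᵇ′-false n<m

forbidden-off-diagonal : ∀ r {x y} → x ≢ y → forbidden r (x , y) ≡ false
forbidden-off-diagonal r x≢y rewrite ≡ᵇ-false x≢y = refl

forbidden-beyond : ∀ r {x y} → r < x → forbidden r (x , y) ≡ false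
forbidden-beyond r {x} {y} r<x rewrite ≤ᵇ′-false r<x =
  trans (cong ((x ≡ᵇ y) ∧_) (∧-zeroʳ (1 ≤ᵇ' x))) (∧-zeroʳ (x ≡ᵇ y))

forbidden-diagonal : ∀ {r d} → 1 ≤ d → d ≤ r → forbidden r (d , d) ≡ true
forbidden-diagonal {d = d} 1≤d d≤r rewrite ≡ᵇ-refl d | ≤ᵇ′-true 1≤d | ≤ᵇ′-true d≤r = refl

forbidden-swap : ∀ r q → forbidden r (swap q) ≡ forbidden r q
forbidden-swap r (x , y) with x ≟ y
... | yes refl = refl
... | no  x≢y  = trans (forbidden-off-diagonal r (x≢y ∘ sym)) (sym (forbidden-off-diagonal r x≢y))

forbidden-suc : ∀ r q → q ≢ (suc r , suc r) → forbidden (suc r) q ≡ forbidden r q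
forbidden-suc r (x , y) q≢corner with x ≟ y
... | no x≢y = trans (forbidden-off-diagonal (suc r) x≢y) (sym (forbidden-off-diagonal r x≢y))
... | yes refl rewrite ≡ᵇ-refl x with <-cmp x (suc r)
...   | tri< x≤r _ _ rewrite ≤ᵇ′-true (<⇒≤ x≤r) | ≤ᵇ′-true (s≤s⁻¹ x≤r) = refl
...   | tri≈ _ refl _ = ⊥-elim (q≢corner refl)
...   | tri> _ _ r<x rewrite ≤ᵇ′-false r<x | ≤ᵇ′-false (m<n⇒m<1+n r<x) = refl

module Ballot (r : ℕ) {X Y : ℕ} (Y<X : Y < X) (Y≤r : Y ≤ r) where

  #paths-from-diagonal≡0 : ∀ ℓ d → #paths (forbidden r) ℓ (suc d , suc d) (X , Y) ≡ 0
  #paths-from-diagonal≡0 ℓ d with suc d ≤? r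
  ... | yes d<r = #paths-from-bad (forbidden r) ℓ (forbidden-diagonal (s≤s z≤n) d<r)
  ... | no  d≮r = #paths-unreachable (forbidden r) ℓ (λ (_ , d<Y) → d≮r (≤-trans d<Y Y≤r))

  #paths-from-above≡0 : ∀ ℓ x y → x < y → #paths (forbidden r) ℓ (x , y) (X , Y) ≡ 0
  #paths-from-above≡0 zero    x y x<y = #paths-miss (forbidden r) {x , y} λ { refl → <-asym x<y Y<X }
  #paths-from-above≡0 (suc ℓ) x y x<y =
    trans (#paths-step (forbidden r) ℓ (forbidden-off-diagonal r (<⇒≢ x<y)))
          (cong₂ _+_ east (#paths-from-above≡0 ℓ x (suc y) (m<n⇒m<1+n x<y)))
    where
    east : #paths (forbidden r) ℓ (suc x , y) (X , Y) ≡ 0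
    east with m≤n⇒m<n∨m≡n x<y
    ... | inj₁ x+1<y = #paths-from-above≡0 ℓ (suc x) y x+1<y
    ... | inj₂ refl  = #paths-from-diagonal≡0 ℓ x

  -- André's reflection principle: the free paths from (x, y) that touch the diagonal
  -- are as many as all free paths from the mirror point (y, x).
  reflection : ∀ ℓ x y → y < x →
               #paths (forbidden r) ℓ (x , y) (X , Y) + #paths free ℓ (y , x) (X , Y) ≡ #paths free ℓ (x , y) (X , Y)
  reflection zero x y y<x rewrite forbidden-off-diagonal r (>⇒≢ y<x) =
    trans (cong (#paths free 0 (x , y) (X , Y) +_) (#paths-miss free {y , x} λ { refl → <-asym y<x Y<X })) (+-identityʳ _)
  reflection (suc ℓ) x y y<x = begin
    #paths (forbidden r) (suc ℓ) (x , y) t + #paths free (suc ℓ) (y , x) t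
      ≡⟨ cong (_+ #paths free (suc ℓ) (y , x) t) (#paths-step (forbidden r) ℓ (forbidden-off-diagonal r (>⇒≢ y<x))) ⟩
    (#paths (forbidden r) ℓ (suc x , y) t + #paths (forbidden r) ℓ (x , suc y) t) + (#paths free ℓ (suc y , x) t + #paths free ℓ (y , suc x) t)
      ≡⟨ regroup (#paths (forbidden r) ℓ (suc x , y) t) _ _ _ ⟩
    (#paths (forbidden r) ℓ (suc x , y) t + #paths free ℓ (y , suc x) t) + (#paths (forbidden r) ℓ (x , suc y) t + #paths free ℓ (suc y , x) t)
      ≡⟨ cong₂ _+_ (reflection ℓ (suc x) y (m<n⇒m<1+n y<x)) north ⟩
    #paths free ℓ (suc x , y) t + #paths free ℓ (x , suc y) t ∎
    where
    open ≡-Reasoning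
    t = (X , Y)
    regroup : ∀ a b c d → (a + b) + (c + d) ≡ (a + d) + (b + c)
    regroup = solve-∀
    north : #paths (forbidden r) ℓ (x , suc y) t + #paths free ℓ (suc y , x) t ≡ #paths free ℓ (x , suc y) t
    north with m≤n⇒m<n∨m≡n y<x
    ... | inj₁ y+1<x = reflection ℓ x (suc y) y+1<x
    ... | inj₂ refl  = cong (_+ #paths free ℓ (x , x) t) (#paths-from-diagonal≡0 ℓ y)

nCk*k![n∸k]!≡n! : ∀ {n k} → k ≤ n → (n C k) * (k ! * (n ∸ k) !) ≡ n !
nCk*k![n∸k]!≡n! {n} {k} k≤n = trans (cong (_* (k ! * (n ∸ k) !)) (nCk≡n!/k![n-k]! k≤n)) (m/n*n≡m (k![n∸k]!∣n! k≤n))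
  where instance _ = k !* (n ∸ k) !≢0

[n∸k]*nCk≡[1+k]*nC[1+k] : ∀ {n k} → k < n → (n ∸ k) * (n C k) ≡ suc k * (n C suc k)
[n∸k]*nCk≡[1+k]*nC[1+k] {n} {k} k<n = *-cancelʳ-≡ _ _ (suc k ! * (n ∸ suc k) !) {{suc k !* (n ∸ suc k) !≢0}} (begin
  (n ∸ k) * (n C k) * (suc k ! * (n ∸ suc k) !)   ≡⟨ *-assoc (n ∸ k) (n C k) _ ⟩
  (n ∸ k) * ((n C k) * (suc k ! * (n ∸ suc k) !)) ≡⟨ x*[y*z]≡y*[x*z] (n ∸ k) (n C k) _ ⟩
  (n C k) * ((n ∸ k) * (suc k ! * (n ∸ suc k) !)) ≡⟨ cong ((n C k) *_) ([n-k]*d[k+1]≡[k+1]*d[k] k<n) ⟩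
  (n C k) * (suc k * (k ! * (n ∸ k) !))           ≡⟨ x*[y*z]≡y*[x*z] (n C k) (suc k) _ ⟩
  suc k * ((n C k) * (k ! * (n ∸ k) !))           ≡⟨ cong (suc k *_) (nCk*k![n∸k]!≡n! (<⇒≤ k<n)) ⟩
  suc k * n !                                     ≡⟨ cong (suc k *_) (nCk*k![n∸k]!≡n! k<n) ⟨
  suc k * ((n C suc k) * (suc k ! * (n ∸ suc k) !)) ≡⟨ *-assoc (suc k) (n C suc k) _ ⟨
  suc k * (n C suc k) * (suc k ! * (n ∸ suc k) !) ∎)
  where
  open ≡-Reasoning
  x*[y*z]≡y*[x*z] : ∀ x y z → x * (y * z) ≡ y * (x * z)
  x*[y*z]≡y*[x*z] = solve-∀

catalan≡[r+r]Cr∸[r+r]C[1+r] : ∀ r → catalan r ≡ (r + r) C r ∸ (r + r) C suc r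
catalan≡[r+r]Cr∸[r+r]C[1+r] zero        = refl
catalan≡[r+r]Cr∸[r+r]C[1+r] r@(suc _) = begin
  ((2 * r) C r) / suc r          ≡⟨ cong (λ n → (n C r) / suc r) (cong (r +_) (+-identityʳ r)) ⟩
  a / suc r                      ≡⟨ cong (_/ suc r) difference*[1+r] ⟨
  (a ∸ b) * suc r / suc r        ≡⟨ m*n/n≡m (a ∸ b) (suc r) ⟩
  a ∸ b                          ∎
  where
  open ≡-Reasoning
  a = (r + r) C r
  b = (r + r) C suc r
  difference*[1+r] : (a ∸ b) * suc r ≡ a
  difference*[1+r] = begin
    (a ∸ b) * suc r         ≡⟨ *-distribʳ-∸ (suc r) a b ⟩
    a * suc r ∸ b * suc r   ≡⟨ cong₂ _∸_ (*-suc a r) (*-comm b (suc r)) ⟩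
    a + a * r ∸ suc r * b   ≡⟨ cong (λ c → a + a * r ∸ c) ([n∸k]*nCk≡[1+k]*nC[1+k] (m<m+n r (s≤s z≤n))) ⟨
    a + a * r ∸ (r + r ∸ r) * a ≡⟨ cong₂ (λ u v → a + u ∸ v * a) (*-comm a r) (m+n∸m≡n r r) ⟩
    a + r * a ∸ r * a       ≡⟨ m+n∸n≡m a (r * a) ⟩
    a                       ∎

[2+2m]C[1+m]≡2*[1+2m]C[1+m] : ∀ m → (2 * suc m) C suc m ≡ 2 * ((suc m + m) C suc m)
[2+2m]C[1+m]≡2*[1+2m]C[1+m] m = begin
  (2 * suc m) C suc m                     ≡⟨ cong (_C suc m) (doubled m) ⟩
  suc n C suc m                           ≡⟨ nCk+nC[k+1]≡[n+1]C[k+1] n m ⟨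
  n C m + n C suc m                       ≡⟨ cong (_+ n C suc m) symmetric ⟩
  n C suc m + n C suc m                   ≡⟨ cong (n C suc m +_) (+-identityʳ (n C suc m)) ⟨
  2 * (n C suc m)                         ∎
  where
  open ≡-Reasoning
  n = suc m + m
  doubled : ∀ m → 2 * suc m ≡ suc (suc m + m)
  doubled = solve-∀
  symmetric : n C m ≡ n C suc m
  symmetric = trans (nCk≡nC[n∸k] (m≤n+m m (suc m))) (cong (n C_) (m+n∸n≡m (suc m) m))

ballot : ∀ r → #paths (forbidden r) (suc (r + r)) (0 , 0) (suc r , r) ≡ catalan r
ballot zero        = refl
ballot r@(suc r-1) = begin
  #paths (forbidden r) (r + r) (1 , 0) t + #paths (forbidden r) (r + r) (0 , 1) t
    ≡⟨ cong (#paths (forbidden r) (r + r) (1 , 0) t +_) (#paths-from-above≡0 (r + r) 0 1 (s≤s z≤n)) ⟩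
  #paths (forbidden r) (r + r) (1 , 0) t + 0
    ≡⟨ +-identityʳ _ ⟩
  #paths (forbidden r) (r + r) (1 , 0) t
    ≡⟨ m+n∸n≡m _ (#paths free (r + r) (0 , 1) t) ⟨
  #paths (forbidden r) (r + r) (1 , 0) t + #paths free (r + r) (0 , 1) t ∸ #paths free (r + r) (0 , 1) t
    ≡⟨ cong (_∸ #paths free (r + r) (0 , 1) t) (reflection (r + r) 1 0 (s≤s z≤n)) ⟩
  #paths free (r + r) (1 , 0) t ∸ #paths free (r + r) (0 , 1) t
    ≡⟨ cong₂ _∸_ (#free-paths (r + r) r r 1 0 refl) (#free-paths (r + r) (suc r) r-1 0 1 (cong suc (sym (+-suc r-1 r-1)))) ⟩
  (r + r) C r ∸ (r + r) C suc r
    ≡⟨ catalan≡[r+r]Cr∸[r+r]C[1+r] r ⟨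
  catalan r ∎
  where
  open ≡-Reasoning
  open Ballot r (n<1+n r) ≤-refl
  t = (suc r , r)

#paths-to-corner : ∀ r → #paths (forbidden r) (suc r + suc r) (0 , 0) (suc r , suc r) ≡ catalan r + catalan r
#paths-to-corner r = begin
  #paths (forbidden r) (suc r + suc r) (0 , 0) (suc r , suc r)
    ≡⟨ #paths-last (forbidden r) (forbidden-beyond r {suc r} {suc r} ≤-refl) (r + suc r) (0 , 0) ⟩
  #paths (forbidden r) (r + suc r) (0 , 0) (r , suc r) + #paths (forbidden r) (r + suc r) (0 , 0) (suc r , r)
    ≡⟨ cong (_+ #paths (forbidden r) (r + suc r) (0 , 0) (suc r , r)) (#paths-swap (forbidden r) (forbidden-swap r) (r + suc r) (0 , 0) (r , suc r)) ⟩
  #paths (forbidden r) (r + suc r) (0 , 0) (suc r , r) + #paths (forbidden r) (r + suc r) (0 , 0) (suc r , r)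
    ≡⟨ cong₂ _+_ below-diagonal below-diagonal ⟩
  catalan r + catalan r ∎
  where
  open ≡-Reasoning
  below-diagonal : #paths (forbidden r) (r + suc r) (0 , 0) (suc r , r) ≡ catalan r
  below-diagonal = trans (cong (λ ℓ → #paths (forbidden r) ℓ (0 , 0) (suc r , r)) (+-suc r r)) (ballot r)

#paths-from-corner : ∀ r a b → #paths (forbidden r) (a + b) (suc r , suc r) (suc r + a , suc r + b) ≡ (a + b) C a
#paths-from-corner r a b =
  trans (#paths-cong (forbidden r) free (a + b) (λ { (x , y) (r<x , _) → forbidden-beyond r r<x }))
        (#free-paths (a + b) a b (suc r) (suc r) refl)

Q-one : ∀ r → Q 1 r ≡ catalan r
Q-one r = trans (Q≡#paths 1 r refl) (ballot r)

Q-recurrence : ∀ m r → Q (2 + m) r ≡ Q (1 + m) (suc r) + catalan r * ((2 * suc m) C suc m)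
Q-recurrence m r = begin
  Q (2 + m) r
    ≡⟨ Q≡#paths (2 + m) r refl ⟩
  #paths (forbidden r) (K + (K ∸ 1)) (0 , 0) t
    ≡⟨ cong (λ ℓ → #paths (forbidden r) ℓ (0 , 0) t) lengths ⟨
  #paths (forbidden r) (ℓ + ℓ′) (0 , 0) t
    ≡⟨ #paths-through (forbidden r) (forbidden (suc r)) corner (forbidden-beyond r {suc r} {suc r} ≤-refl)
                      (forbidden-diagonal {suc r} {suc r} (s≤s z≤n) ≤-refl) (forbidden-suc r) ℓ ℓ′ (0 , 0) t lengths ⟩
  #paths (forbidden (suc r)) (ℓ + ℓ′) (0 , 0) t + #paths (forbidden r) ℓ (0 , 0) corner * #paths (forbidden r) ℓ′ corner t
    ≡⟨ cong₂ _+_ avoiding-corner (cong₂ _*_ (#paths-to-corner r) from-corner) ⟩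
  Q (1 + m) (suc r) + (catalan r + catalan r) * (ℓ′ C suc m)
    ≡⟨ cong (Q (1 + m) (suc r) +_) (trans (double-factor (catalan r) (ℓ′ C suc m))
                                          (cong (catalan r *_) (sym ([2+2m]C[1+m]≡2*[1+2m]C[1+m] m)))) ⟩
  Q (1 + m) (suc r) + catalan r * ((2 * suc m) C suc m) ∎
  where
  open ≡-Reasoning
  K = 2 + m + r
  t = (K , K ∸ 1)
  corner = (suc r , suc r)
  ℓ = suc r + suc r
  ℓ′ = suc m + m
  lengths : ℓ + ℓ′ ≡ K + (K ∸ 1)
  lengths = total m r
    where
    total : ∀ m r → (suc r + suc r) + (suc m + m) ≡ suc (suc (m + r)) + suc (m + r)
    total = solve-∀
  avoiding-corner : #paths (forbidden (suc r)) (ℓ + ℓ′) (0 , 0) t ≡ Q (1 + m) (suc r)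
  avoiding-corner = trans (cong (λ ℓ → #paths (forbidden (suc r)) ℓ (0 , 0) t) lengths)
                          (sym (Q≡#paths (1 + m) (suc r) (cong suc (+-suc m r))))
  from-corner : #paths (forbidden r) ℓ′ corner t ≡ ℓ′ C suc m
  from-corner = subst (λ t′ → #paths (forbidden r) ℓ′ corner t′ ≡ ℓ′ C suc m)
                      (cong₂ _,_ (cong suc (trans (+-suc r m) (cong suc (+-comm r m)))) (cong suc (+-comm r m)))
                      (#paths-from-corner r (suc m) m)
  double-factor : ∀ c b → (c + c) * b ≡ c * (2 * b)
  double-factor = solve-∀

sum1to-cong : ∀ n {f g : ℕ → ℕ} → (∀ k → f k ≡ g k) → sum1to n f ≡ sum1to n g
sum1to-cong zero    f≗g = refl
sum1to-cong (suc n) f≗g = cong₂ _+_ (sum1to-cong n f≗g) (f≗g (suc n))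

sum1to-peel : ∀ n f → sum1to (suc n) f ≡ f 1 + sum1to n (f ∘ suc)
sum1to-peel zero    f = +-comm 0 (f 1)
sum1to-peel (suc n) f = trans (cong (_+ f (suc (suc n))) (sum1to-peel n f)) (+-assoc (f 1) _ _)

summand : ℕ → ℕ → ℕ → ℕ
summand n r k = catalan (r + k ∸ 1) * ((2 * (n ∸ k)) C (n ∸ k))

summand-shift : ∀ n r k → summand (suc n) r (suc k) ≡ summand n (suc r) k
summand-shift n r k = cong (λ i → catalan (i ∸ 1) * ((2 * (n ∸ k)) C (n ∸ k))) (+-suc r k)

Q≡sum : ∀ m r → Q (suc m) r ≡ sum1to (suc m) (summand (suc m) r)
Q≡sum zero    r = trans (Q-one r) (sym (trans (*-identityʳ _) (cong catalan (m+n∸n≡m r 1))))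
Q≡sum (suc m) r = begin
  Q (2 + m) r
    ≡⟨ Q-recurrence m r ⟩
  Q (1 + m) (suc r) + catalan r * b
    ≡⟨ cong (_+ catalan r * b) (Q≡sum m (suc r)) ⟩
  sum1to (suc m) (summand (suc m) (suc r)) + catalan r * b
    ≡⟨ +-comm _ (catalan r * b) ⟩
  catalan r * b + sum1to (suc m) (summand (suc m) (suc r))
    ≡⟨ cong₂ _+_ (cong (λ i → catalan i * b) (m+n∸n≡m r 1)) (sum1to-cong (suc m) (summand-shift (suc m) r)) ⟨
  summand (2 + m) r 1 + sum1to (suc m) (summand (2 + m) r ∘ suc)
    ≡⟨ sum1to-peel (suc m) (summand (2 + m) r) ⟨
  sum1to (2 + m) (summand (2 + m) r) ∎
  where
  open ≡-Reasoning
  b = (2 * suc m) C suc m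

proposition4 : (n r : ℕ) → n ≥ 1 → r ≥ 1 →
    Q n r ≡ sum1to n (λ k → catalan (r + k ∸ 1) * ((2 * (n ∸ k)) C (n ∸ k)))
proposition4 (suc m) r _ _ = Q≡sum m r
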